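{- Let $k\geq 1$, $n\geq 2k+1$ and $r\geq 2$ be integers. The geometry $\Gamma(KG(n,k),r)$ is residually connected.
   Context: Let $\Omega=\{1,\ldots,n+k(r-2)\}$, $I=\{1,\ldots,r\}$. The incidence system $\Gamma(KG(n,k),r)=(X,*,t,I)$ has element set $X=X_1\cup\cdots\cup X_r$, a disjoint union of $r$ copies of the set of all $k$-subsets of $\Omega$; $t(x)=i$ for $x\in X_i$; $x\in X_i$ and $y\in X_j$ are incident iff $x=y$ or ($i\neq j$ and $x\cap y=\emptyset$). The incidence graph has vertex set $X$ with distinct incident elements adjacent. A flag is a set of pairwise incident elements. The residue of a flag $F$ is the incidence system whose elements are the elements incident to all elements of $F$ but not in $F$, with types $I\setminus t(F)$ and incidence and type function restricted; its rank is $|I\setminus t(F)|$ (the residue of the empty flag is the whole system). The system is residually connected if every residue of rank at least two has a connected incidence graph. -}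

module Defs where

open import Data.Nat using (ℕ; _+_; _*_; _∸_)
open import Data.Fin using (Fin)
open import Data.Fin.Subset using (Subset; ∣_∣; _∩_; _∪_; ⁅_⁆; ∁; Empty; ⊥)
open import Data.Product using (_×_; proj₁; proj₂)
open import Data.Sum using (_⊎_)
open import Data.List using (List; foldr)
open import Data.List.Membership.Propositional using (_∈_; _∉_)
open import Data.List.Relation.Unary.All using (All)
open import Relation.Binary.PropositionalEquality using (_≡_; _≢_)

-- Ω = {1,…,n + k(r-2)} is modelled as Fin (n + k * (r ∸ 2)); I = {1,…,r} as Fin r.
ΩSize : ℕ → ℕ → ℕ → ℕ
ΩSize n k r = n + k * (r ∸ 2)

-- A candidate element: a type i ∈ I together with a subset of Ω.
-- The element (i , s) lies in X (i.e. in X_i) iff |s| = k.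
Elem : ℕ → ℕ → Set
Elem r N = Fin r × Subset N

type : ∀ {r N} → Elem r N → Fin r
type = proj₁

module KG (n k r : ℕ) where

  N : ℕ
  N = ΩSize n k r

  E : Set
  E = Elem r N

  InX : E → Set
  InX x = ∣ proj₂ x ∣ ≡ k

  Inc : E → E → Set
  Inc x y = (x ≡ y) ⊎ ((proj₁ x ≢ proj₁ y) × Empty (proj₂ x ∩ proj₂ y))

  IsFlag : List E → Set
  IsFlag F = All InX F × (∀ {x y} → x ∈ F → y ∈ F → Inc x y)

  types : List E → Subset r
  types F = foldr (λ x s → ⁅ type x ⁆ ∪ s) ⊥ F

  rank : List E → ℕ
  rank F = ∣ ∁ (types F) ∣

  -- elements of the residue of F: elements of X incident to all of F, not in F
  -- (their types automatically lie in I \ t(F))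
  InRes : List E → E → Set
  InRes F x = InX x × All (λ f → Inc f x) F × x ∉ F

  data Walk (F : List E) : E → E → Set where
    stop : ∀ {x} → InRes F x → Walk F x x
    step : ∀ {x y z} → InRes F x → Inc x y → x ≢ y → Walk F y z → Walk F x z

  ResConnected : List E → Set
  ResConnected F = ∀ {x y} → InRes F x → InRes F y → Walk F x y

  ResiduallyConnected : Set
  ResiduallyConnected = ∀ (F : List E) → IsFlag F → 2 Data.Nat.≤ rank F → ResConnected F

-- Let T be the set of types and U the union of the subsets occurring in a flag F.
-- Elements of a flag have pairwise distinct types and disjoint subsets, so
-- |U| ≤ k |T| ≤ k (r - 2) when the residue has rank at least 2; hence the pool
-- D = Ω \ U has at least n ≥ 2k + 1 points. The residue consists of all (i , A)
-- with i ∉ T and A a k-subset of D, and there is a free type j besides any free i.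
-- Two k-subsets A ≠ B of D of the same type i are joined by exchanging one point
-- at a time: pick a ∈ A \ B, b ∈ B \ A and a k-subset C of D avoiding A ∪ {b}
-- (possible because |D| ≥ 2k + 1); then (i , A) — (j , C) — (i , A - a + b),
-- and the last set is one step closer to B. Elements of different types i ≠ j
-- are joined through (i , C) for any k-subset C of D avoiding B.
module Submission where

open import Data.Nat using (ℕ; zero; suc; _≤_; _<_; _+_; _*_; _∸_; z≤n; s≤s; s≤s⁻¹)
open import Data.Nat.Properties
open import Data.Nat.Tactic.RingSolver using (solve-∀)
open import Data.Fin using (Fin; zero; suc)
open import Data.Fin.Properties using () renaming (_≟_ to _≟ᶠ_)
open import Data.Fin.Subset
open import Data.Fin.Subset.Properties
open import Data.Vec using ([]; _∷_; here; there)
open import Data.List using (List; []; _∷_; foldr)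
open import Data.List.Relation.Unary.Any using (here; there)
open import Data.List.Membership.Propositional using () renaming (_∈_ to _∈ˡ_)
import Data.List.Relation.Unary.All as All
open import Data.Product using (_×_; _,_; proj₁; proj₂; ∃)
open import Data.Sum using (_⊎_; inj₁; inj₂; [_,_]′)
open import Function using (_∘_; id)
open import Relation.Nullary using (Dec; yes; no; contradiction)
open import Relation.Binary.PropositionalEquality

open import Defs

private variable
  m k : ℕ
  p q s t : Subset m
  x y z : Fin m

x∈p─q⇒x∉q : ∀ (p q : Subset m) → x ∈ p ─ q → x ∉ q
x∈p─q⇒x∉q (inside ∷ p) (outside ∷ q) here ()
x∈p─q⇒x∉q (_ ∷ p) (_ ∷ q) (there x∈p─q) (there x∈q) = x∈p─q⇒x∉q p q x∈p─q x∈q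

Empty[p─q]⇒p⊆q : ∀ (p q : Subset m) → Empty (p ─ q) → p ⊆ q
Empty[p─q]⇒p⊆q p q p─q-empty {x} x∈p with x ∈? q
... | yes x∈q = x∈q
... | no  x∉q = contradiction (x , x∈p∧x∉q⇒x∈p─q x∈p x∉q) p─q-empty

p⊆q∧∣p∣≡∣q∣⇒p≡q : p ⊆ q → ∣ p ∣ ≡ ∣ q ∣ → p ≡ q
p⊆q∧∣p∣≡∣q∣⇒p≡q {p = p} {q} p⊆q ∣p∣≡∣q∣ with nonempty? (q ─ p)
... | no  q─p-empty = ⊆-antisym p⊆q (Empty[p─q]⇒p⊆q q p q─p-empty)
... | yes (x , x∈q─p) =
  contradiction ∣p∣≡∣q∣ (<⇒≢ (p⊂q⇒∣p∣<∣q∣ (p⊆q , x , p─q⊆p q p x∈q─p , x∈p─q⇒x∉q q p x∈q─p)))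

∣p∣≡∣q∣⇒Nonempty[q─p] : ∣ p ∣ ≡ ∣ q ∣ → Nonempty (p ─ q) → Nonempty (q ─ p)
∣p∣≡∣q∣⇒Nonempty[q─p] {p = p} {q} ∣p∣≡∣q∣ (x , x∈p─q) with nonempty? (q ─ p)
... | yes q─p-nonempty = q─p-nonempty
... | no  q─p-empty = contradiction (p─q⊆p p q x∈p─q) (subst (x ∉_) q≡p (x∈p─q⇒x∉q p q x∈p─q))
  where
  q≡p : q ≡ p
  q≡p = p⊆q∧∣p∣≡∣q∣⇒p≡q (Empty[p─q]⇒p⊆q q p q─p-empty) (sym ∣p∣≡∣q∣)

2≤∣p∣⇒∃≢ : 2 ≤ ∣ p ∣ → ∃ λ y → y ∈ p × y ≢ x
2≤∣p∣⇒∃≢ {p = p} {x} 2≤∣p∣ with nonempty? (p - x)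
... | yes (y , y∈p-x) = y , p─q⊆p p ⁅ x ⁆ y∈p-x , x∉⁅y⁆⇒x≢y (x∈p─q⇒x∉q p ⁅ x ⁆ y∈p-x)
... | no  p-x-empty = contradiction (≤-trans 2≤∣p∣ ∣p∣≤1) (λ { (s≤s ()) })
  where
  ∣p∣≤1 : ∣ p ∣ ≤ 1
  ∣p∣≤1 = ≤-trans (p⊆q⇒∣p∣≤∣q∣ (Empty[p─q]⇒p⊆q p ⁅ x ⁆ p-x-empty)) (≤-reflexive (∣⁅x⁆∣≡1 x))

∣p∪q∣≤∣p∣+∣q∣ : ∀ (p q : Subset m) → ∣ p ∪ q ∣ ≤ ∣ p ∣ + ∣ q ∣
∣p∪q∣≤∣p∣+∣q∣ [] [] = ≤-refl
∣p∪q∣≤∣p∣+∣q∣ (inside ∷ p) (inside ∷ q) =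
  s≤s (≤-trans (∣p∪q∣≤∣p∣+∣q∣ p q) (+-monoʳ-≤ ∣ p ∣ (n≤1+n ∣ q ∣)))
∣p∪q∣≤∣p∣+∣q∣ (inside ∷ p) (outside ∷ q) = s≤s (∣p∪q∣≤∣p∣+∣q∣ p q)
∣p∪q∣≤∣p∣+∣q∣ (outside ∷ p) (inside ∷ q) =
  subst (suc ∣ p ∪ q ∣ ≤_) (sym (+-suc ∣ p ∣ ∣ q ∣)) (s≤s (∣p∪q∣≤∣p∣+∣q∣ p q))
∣p∪q∣≤∣p∣+∣q∣ (outside ∷ p) (outside ∷ q) = ∣p∪q∣≤∣p∣+∣q∣ p q

∣p∣≤∣p─q∣+∣q∣ : ∀ (p q : Subset m) → ∣ p ∣ ≤ ∣ p ─ q ∣ + ∣ q ∣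
∣p∣≤∣p─q∣+∣q∣ p q = ≤-trans (p⊆q⇒∣p∣≤∣q∣ p⊆[p─q]∪q) (∣p∪q∣≤∣p∣+∣q∣ (p ─ q) q)
  where
  p⊆[p─q]∪q : p ⊆ (p ─ q) ∪ q
  p⊆[p─q]∪q {x} x∈p with x ∈? q
  ... | yes x∈q = q⊆p∪q (p ─ q) q x∈q
  ... | no  x∉q = p⊆p∪q q (x∈p∧x∉q⇒x∈p─q x∈p x∉q)

x∉p⇒∣⁅x⁆∪p∣≡1+∣p∣ : ∀ (p : Subset m) → x ∉ p → ∣ ⁅ x ⁆ ∪ p ∣ ≡ suc ∣ p ∣
x∉p⇒∣⁅x⁆∪p∣≡1+∣p∣ {x = zero}  (inside  ∷ p) x∉p = contradiction here x∉p
x∉p⇒∣⁅x⁆∪p∣≡1+∣p∣ {x = zero}  (outside ∷ p) x∉p = cong (suc ∘ ∣_∣) (∪-identityˡ p)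
x∉p⇒∣⁅x⁆∪p∣≡1+∣p∣ {x = suc x} (inside  ∷ p) x∉p = cong suc (x∉p⇒∣⁅x⁆∪p∣≡1+∣p∣ p (x∉p ∘ there))
x∉p⇒∣⁅x⁆∪p∣≡1+∣p∣ {x = suc x} (outside ∷ p) x∉p = x∉p⇒∣⁅x⁆∪p∣≡1+∣p∣ p (x∉p ∘ there)

x∈p⇒1+∣p-x∣≡∣p∣ : ∀ (p : Subset m) → x ∈ p → suc ∣ p - x ∣ ≡ ∣ p ∣
x∈p⇒1+∣p-x∣≡∣p∣ (inside  ∷ p) here        = cong (suc ∘ ∣_∣) (p─⊥≡p p)
x∈p⇒1+∣p-x∣≡∣p∣ (inside  ∷ p) (there x∈p) = cong suc (x∈p⇒1+∣p-x∣≡∣p∣ p x∈p)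
x∈p⇒1+∣p-x∣≡∣p∣ (outside ∷ p) (there x∈p) = x∈p⇒1+∣p-x∣≡∣p∣ p x∈p

choose : ∀ k (p : Subset m) → k ≤ ∣ p ∣ → ∃ λ s → s ⊆ p × ∣ s ∣ ≡ k
choose {m} zero p _ = ⊥ , (λ x∈⊥ → contradiction x∈⊥ ∉⊥) , ∣⊥∣≡0 m
choose (suc k) (inside ∷ p) k<∣p∣ =
  let (s , s⊆p , ∣s∣≡k) = choose k p (s≤s⁻¹ k<∣p∣) in inside ∷ s , in⊆in s⊆p , cong suc ∣s∣≡k
choose (suc k) (outside ∷ p) k<∣p∣ =
  let (s , s⊆p , ∣s∣≡1+k) = choose (suc k) p k<∣p∣ in outside ∷ s , out⊆ s⊆p , ∣s∣≡1+k

chooseAvoiding : ∀ k (p q : Subset m) → k + ∣ q ∣ ≤ ∣ p ∣ → ∃ λ s → s ⊆ p ─ q × ∣ s ∣ ≡ k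
chooseAvoiding k p q k+∣q∣≤∣p∣ =
  choose k (p ─ q) (+-cancelʳ-≤ ∣ q ∣ k (∣ p ─ q ∣) (≤-trans k+∣q∣≤∣p∣ (∣p∣≤∣p─q∣+∣q∣ p q)))

⊆p─q∧⊆q⇒Empty[∩] : s ⊆ p ─ q → t ⊆ q → Empty (s ∩ t)
⊆p─q∧⊆q⇒Empty[∩] {s = s} {p} {q} {t} s⊆p─q t⊆q (x , x∈s∩t) =
  let (x∈s , x∈t) = x∈p∩q⁻ s t x∈s∩t in x∈p─q⇒x∉q p q (s⊆p─q x∈s) (t⊆q x∈t)

replace : Subset m → Fin m → Fin m → Subset m
replace p y z = ⁅ z ⁆ ∪ (p - y)

∈-replace⁻ : ∀ (p : Subset m) → x ∈ replace p y z → x ≡ z ⊎ (x ∈ p × x ≢ y)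
∈-replace⁻ {y = y} {z} p x∈ with x∈p∪q⁻ ⁅ z ⁆ (p - y) x∈
... | inj₁ x∈⁅z⁆ = inj₁ (x∈⁅y⁆⇒x≡y z x∈⁅z⁆)
... | inj₂ x∈p-y = inj₂ (p─q⊆p p ⁅ y ⁆ x∈p-y , x∉⁅y⁆⇒x≢y (x∈p─q⇒x∉q p ⁅ y ⁆ x∈p-y))

∣replace∣ : ∀ (p : Subset m) → y ∈ p → z ∉ p → ∣ replace p y z ∣ ≡ ∣ p ∣
∣replace∣ {y = y} p y∈p z∉p =
  trans (x∉p⇒∣⁅x⁆∪p∣≡1+∣p∣ (p - y) (z∉p ∘ p─q⊆p p ⁅ y ⁆)) (x∈p⇒1+∣p-x∣≡∣p∣ p y∈p)

replace-─⊂ : ∀ (p q : Subset m) → y ∈ p ─ q → z ∈ q → replace p y z ─ q ⊂ p ─ q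
replace-─⊂ {y = y} {z} p q y∈p─q z∈q = shrinks , y , y∈p─q , y∉
  where
  shrinks : replace p y z ─ q ⊆ p ─ q
  shrinks x∈ with ∈-replace⁻ p (p─q⊆p _ q x∈)
  ... | inj₁ refl = contradiction z∈q (x∈p─q⇒x∉q _ q x∈)
  ... | inj₂ (x∈p , _) = x∈p∧x∉q⇒x∈p─q x∈p (x∈p─q⇒x∉q _ q x∈)
  y∉ : y ∉ replace p y z ─ q
  y∉ y∈ with ∈-replace⁻ p (p─q⊆p _ q y∈)
  ... | inj₁ refl = x∈p─q⇒x∉q p q y∈p─q z∈q
  ... | inj₂ (_ , y≢y) = y≢y refl

record Exchange (k : ℕ) (D A B : Subset m) : Set where
  field
    middle next   : Subset m
    middle⊆D      : middle ⊆ D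
    ∣middle∣      : ∣ middle ∣ ≡ k
    next⊆D        : next ⊆ D
    ∣next∣        : ∣ next ∣ ≡ k
    A∩middle-empty    : Empty (A ∩ middle)
    middle∩next-empty : Empty (middle ∩ next)
    closer        : ∣ next ─ B ∣ < ∣ A ─ B ∣

exchange : ∀ {D A B : Subset m} → k + suc k ≤ ∣ D ∣ → A ⊆ D → B ⊆ D →
           ∣ A ∣ ≡ k → ∣ B ∣ ≡ k → Nonempty (A ─ B) → Exchange k D A B
exchange {k = k} {D} {A} {B} large A⊆D B⊆D ∣A∣ ∣B∣ (a , a∈A─B) = record
  { middle            = C
  ; next              = replace A a b
  ; middle⊆D          = p─q⊆p D P ∘ C⊆D─P
  ; ∣middle∣          = ∣C∣
  ; next⊆D            = [ (λ { refl → B⊆D b∈B }) , A⊆D ∘ proj₁ ]′ ∘ ∈-replace⁻ A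
  ; ∣next∣            = trans (∣replace∣ A a∈A b∉A) ∣A∣
  ; A∩middle-empty    = subst Empty (∩-comm C A) (⊆p─q∧⊆q⇒Empty[∩] C⊆D─P (q⊆p∪q ⁅ b ⁆ A))
  ; middle∩next-empty = ⊆p─q∧⊆q⇒Empty[∩] C⊆D─P next⊆P
  ; closer            = p⊂q⇒∣p∣<∣q∣ (replace-─⊂ A B a∈A─B b∈B)
  }
  where
  a∈A = p─q⊆p A B a∈A─B
  b-spec = ∣p∣≡∣q∣⇒Nonempty[q─p] (trans ∣A∣ (sym ∣B∣)) (a , a∈A─B)
  b = proj₁ b-spec
  b∈B = p─q⊆p B A (proj₂ b-spec)
  b∉A = x∈p─q⇒x∉q B A (proj₂ b-spec)
  P = ⁅ b ⁆ ∪ A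
  ∣P∣≤1+k : ∣ P ∣ ≤ suc k
  ∣P∣≤1+k = ≤-trans (∣p∪q∣≤∣p∣+∣q∣ ⁅ b ⁆ A) (≤-reflexive (cong₂ _+_ (∣⁅x⁆∣≡1 b) ∣A∣))
  C-spec = chooseAvoiding k D P (≤-trans (+-monoʳ-≤ k ∣P∣≤1+k) large)
  C = proj₁ C-spec
  C⊆D─P = proj₁ (proj₂ C-spec)
  ∣C∣ = proj₂ (proj₂ C-spec)
  next⊆P : replace A a b ⊆ P
  next⊆P = [ (λ { refl → p⊆p∪q A (x∈⁅x⁆ b) }) , q⊆p∪q ⁅ b ⁆ A ∘ proj₁ ]′ ∘ ∈-replace⁻ A

⋃[_]_ : {X : Set} → (X → Subset m) → List X → Subset m
⋃[ g ] xs = foldr (λ a s → g a ∪ s) ⊥ xs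

∈⋃⁺ : {X : Set} (g : X → Subset m) {a : X} {xs : List X} → a ∈ˡ xs → x ∈ g a → x ∈ ⋃[ g ] xs
∈⋃⁺ g {xs = b ∷ xs} (here refl) x∈ga = p⊆p∪q (⋃[ g ] xs) x∈ga
∈⋃⁺ g {xs = b ∷ xs} (there a∈xs) x∈ga = q⊆p∪q (g b) (⋃[ g ] xs) (∈⋃⁺ g a∈xs x∈ga)

∈⋃⁻ : {X : Set} (g : X → Subset m) (xs : List X) → x ∈ ⋃[ g ] xs → ∃ λ a → a ∈ˡ xs × x ∈ g a
∈⋃⁻ g [] x∈ = contradiction x∈ ∉⊥
∈⋃⁻ g (a ∷ xs) x∈ with x∈p∪q⁻ (g a) (⋃[ g ] xs) x∈
... | inj₁ x∈ga = a , here refl , x∈ga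
... | inj₂ x∈⋃ = let (b , b∈xs , x∈gb) = ∈⋃⁻ g xs x∈⋃ in b , there b∈xs , x∈gb

2k+1≡k+1+k : ∀ k → 2 * k + 1 ≡ k + suc k
2k+1≡k+1+k = solve-∀

module _ (n k r : ℕ) where
  open KG n k r

  support : List E → Subset N
  support F = ⋃[ proj₂ ] F

  type∈types : ∀ {F f} → f ∈ˡ F → type f ∈ types F
  type∈types {f = f} f∈F = ∈⋃⁺ (λ g → ⁅ type g ⁆) f∈F (x∈⁅x⁆ (type f))

  Inc∧sameType⇒≡ : ∀ {x y} → Inc x y → type x ≡ type y → x ≡ y
  Inc∧sameType⇒≡ (inj₁ x≡y) _ = x≡y
  Inc∧sameType⇒≡ (inj₂ (tx≢ty , _)) tx≡ty = contradiction tx≡ty tx≢ty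

  InRes⁺ : ∀ {F i A} → i ∉ types F → A ⊆ ∁ (support F) → ∣ A ∣ ≡ k → InRes F (i , A)
  InRes⁺ {F} {i} {A} i∉T A⊆D ∣A∣ = ∣A∣ , All.tabulate incident , i∉T ∘ type∈types
    where
    incident : ∀ {f} → f ∈ˡ F → Inc f (i , A)
    incident {f} f∈F = inj₂ (i∉T ∘ (λ { refl → type∈types f∈F }) , disjoint)
      where
      disjoint : Empty (proj₂ f ∩ A)
      disjoint (x , x∈f∩A) = let (x∈f , x∈A) = x∈p∩q⁻ (proj₂ f) A x∈f∩A in
        x∈∁p⇒x∉p (A⊆D x∈A) (∈⋃⁺ proj₂ f∈F x∈f)

  InRes⁻ : ∀ {F i A} → InRes F (i , A) → i ∉ types F × A ⊆ ∁ (support F)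
  InRes⁻ {F} {i} {A} (_ , incident , ∉F) = i∉T , A⊆D
    where
    proper : ∀ {f} → f ∈ˡ F → type f ≢ i × Empty (proj₂ f ∩ A)
    proper f∈F with All.lookup incident f∈F
    ... | inj₁ refl = contradiction f∈F ∉F
    ... | inj₂ proper-incidence = proper-incidence
    i∉T : i ∉ types F
    i∉T i∈T = let (f , f∈F , i∈⁅tf⁆) = ∈⋃⁻ (λ g → ⁅ type g ⁆) F i∈T in
      proj₁ (proper f∈F) (sym (x∈⁅y⁆⇒x≡y _ i∈⁅tf⁆))
    A⊆D : A ⊆ ∁ (support F)
    A⊆D {x} x∈A = x∉p⇒x∈∁p λ x∈U → let (f , f∈F , x∈f) = ∈⋃⁻ proj₂ F x∈U in
      proj₂ (proper f∈F) (x , x∈p∩q⁺ (x∈f , x∈A))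

  ∣support∣≤k*∣types∣ : ∀ F → IsFlag F → ∣ support F ∣ ≤ k * ∣ types F ∣
  ∣support∣≤k*∣types∣ [] _ = ≤-trans (≤-reflexive (∣⊥∣≡0 N)) z≤n
  ∣support∣≤k*∣types∣ (f ∷ F) (All._∷_ ∣f∣ inX , incident) = bound (type f ∈? types F)
    where
    open ≤-Reasoning
    IH : ∣ support F ∣ ≤ k * ∣ types F ∣
    IH = ∣support∣≤k*∣types∣ F (inX , λ x∈F y∈F → incident (there x∈F) (there y∈F))
    f⊆U : type f ∈ types F → proj₂ f ⊆ support F
    f⊆U tf∈T = let (g , g∈F , tf∈⁅tg⁆) = ∈⋃⁻ (λ g → ⁅ type g ⁆) F tf∈T in
      ∈⋃⁺ proj₂ (subst (_∈ˡ F) (sym (Inc∧sameType⇒≡ (incident (here refl) (there g∈F)) (x∈⁅y⁆⇒x≡y _ tf∈⁅tg⁆))) g∈F)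
    bound : Dec (type f ∈ types F) → ∣ proj₂ f ∪ support F ∣ ≤ k * ∣ ⁅ type f ⁆ ∪ types F ∣
    bound (yes tf∈T) = begin
      ∣ proj₂ f ∪ support F ∣      ≤⟨ p⊆q⇒∣p∣≤∣q∣ (λ x∈ → [ f⊆U tf∈T , id ]′ (x∈p∪q⁻ (proj₂ f) (support F) x∈)) ⟩
      ∣ support F ∣                ≤⟨ IH ⟩
      k * ∣ types F ∣              ≤⟨ *-monoʳ-≤ k (∣q∣≤∣p∪q∣ ⁅ type f ⁆ (types F)) ⟩
      k * ∣ ⁅ type f ⁆ ∪ types F ∣ ∎
    bound (no tf∉T) = begin
      ∣ proj₂ f ∪ support F ∣      ≤⟨ ∣p∪q∣≤∣p∣+∣q∣ (proj₂ f) (support F) ⟩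
      ∣ proj₂ f ∣ + ∣ support F ∣  ≤⟨ +-mono-≤ (≤-reflexive ∣f∣) IH ⟩
      k + k * ∣ types F ∣          ≡⟨ *-suc k ∣ types F ∣ ⟨
      k * suc ∣ types F ∣          ≡⟨ cong (k *_) (x∉p⇒∣⁅x⁆∪p∣≡1+∣p∣ (types F) tf∉T) ⟨
      k * ∣ ⁅ type f ⁆ ∪ types F ∣ ∎

  n≤∣∁support∣ : ∀ F → IsFlag F → 2 ≤ rank F → n ≤ ∣ ∁ (support F) ∣
  n≤∣∁support∣ F flag rank≥2 = begin
    n                       ≡⟨ m+n∸n≡m n (k * (r ∸ 2)) ⟨
    N ∸ k * (r ∸ 2)         ≤⟨ ∸-monoʳ-≤ N (≤-trans (∣support∣≤k*∣types∣ F flag) (*-monoʳ-≤ k ∣T∣≤r∸2)) ⟩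
    N ∸ ∣ support F ∣       ≡⟨ ∣∁p∣≡n∸∣p∣ (support F) ⟨
    ∣ ∁ (support F) ∣       ∎
    where
    open ≤-Reasoning
    T = types F
    ∣T∣≤r∸2 : ∣ T ∣ ≤ r ∸ 2
    ∣T∣≤r∸2 = m+n≤o⇒m≤o∸n ∣ T ∣ (subst (_≤ r) (+-comm 2 ∣ T ∣)
                (m≤o∸n⇒m+n≤o 2 (∣p∣≤n T) (subst (2 ≤_) (∣∁p∣≡n∸∣p∣ T) rank≥2)))

  _◅◅_ : ∀ {F x y z} → Walk F x y → Walk F y z → Walk F x z
  stop _ ◅◅ w′ = w′
  step x∈ x~y x≢y w ◅◅ w′ = step x∈ x~y x≢y (w ◅◅ w′)

  module _ {F : List E} (large : k + suc k ≤ ∣ ∁ (support F) ∣) where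

    edge : ∀ {i j A B z} → InRes F (i , A) → i ≢ j → Empty (A ∩ B) → Walk F (j , B) z → Walk F (i , A) z
    edge A∈ i≢j A∩B-empty = step A∈ (inj₂ (i≢j , A∩B-empty)) (i≢j ∘ cong proj₁)

    walk-sameType : ∀ {i j A B} → i ≢ j → j ∉ types F →
                    InRes F (i , A) → InRes F (i , B) → Walk F (i , A) (i , B)
    walk-sameType {i} {j} {A₀} {B} i≢j j∉T A₀∈ B∈ = go (suc ∣ A₀ ─ B ∣) A₀∈ ≤-refl
      where
      go : ∀ fuel {A} → InRes F (i , A) → ∣ A ─ B ∣ < fuel → Walk F (i , A) (i , B)
      go zero _ ()
      go (suc fuel) {A} A∈ ∣A─B∣<1+fuel with nonempty? (A ─ B)
      ... | no A─B-empty =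
        subst (λ X → Walk F (i , A) (i , X))
              (p⊆q∧∣p∣≡∣q∣⇒p≡q (Empty[p─q]⇒p⊆q A B A─B-empty) (trans (proj₁ A∈) (sym (proj₁ B∈))))
              (stop A∈)
      ... | yes A─B-nonempty =
        edge A∈ i≢j A∩middle-empty
          (edge (InRes⁺ j∉T middle⊆D ∣middle∣) (i≢j ∘ sym) middle∩next-empty
            (go fuel (InRes⁺ (proj₁ (InRes⁻ A∈)) next⊆D ∣next∣) (<-≤-trans closer (s≤s⁻¹ ∣A─B∣<1+fuel))))
        where
        open Exchange (exchange large (proj₂ (InRes⁻ A∈)) (proj₂ (InRes⁻ B∈)) (proj₁ A∈) (proj₁ B∈) A─B-nonempty)

    connected : 2 ≤ rank F → ResConnected F
    connected rank≥2 {i , A} {j , B} A∈ B∈ with i ≟ᶠ j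
    ... | yes refl =
      let (j′ , j′∉T , j′≢i) = 2≤∣p∣⇒∃≢ {x = i} rank≥2 in
      walk-sameType (j′≢i ∘ sym) (x∈∁p⇒x∉p j′∉T) A∈ B∈
    ... | no i≢j =
      walk-sameType i≢j (proj₁ (InRes⁻ B∈)) A∈ C∈ ◅◅ edge C∈ i≢j C∩B-empty (stop B∈)
      where
      ∣B∣ = proj₁ B∈
      C-spec = chooseAvoiding k (∁ (support F)) B
                 (≤-trans (+-monoʳ-≤ k (≤-trans (≤-reflexive ∣B∣) (n≤1+n k))) large)
      C∈ = InRes⁺ (proj₁ (InRes⁻ A∈)) (p─q⊆p _ B ∘ proj₁ (proj₂ C-spec)) (proj₂ (proj₂ C-spec))
      C∩B-empty = ⊆p─q∧⊆q⇒Empty[∩] (proj₁ (proj₂ C-spec)) id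

lemma4p4 : (n k r : ℕ) → 1 ≤ k → 2 * k + 1 ≤ n → 2 ≤ r →
    KG.ResiduallyConnected n k r
lemma4p4 n k r _ 2k+1≤n _ F flag rank≥2 =
  connected n k r large rank≥2
  where
  large : k + suc k ≤ ∣ ∁ (support n k r F) ∣
  large = ≤-trans (≤-reflexive (sym (2k+1≡k+1+k k)))
                  (≤-trans 2k+1≤n (n≤∣∁support∣ n k r F flag rank≥2))
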